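{- Let $k\geq 2$ and let $G_1,\dots,G_k$ be connected graphs, and let $G^*=G_1\Box G_2\Box\cdots\Box G_k$ be their Cartesian product. Then $$sdiam_3(G^*)=\sum_{i=1}^{k} sdiam_3(G_i).$$
   Context: All graphs are simple, connected, undirected. The Steiner distance $d(S)$ of a vertex set $S$ in $G$ is the minimum number of edges of a tree in $G$ containing $S$; the $3$-Steiner diameter $sdiam_3(G)$ is the maximum of $d(S)$ over all $3$-element sets $S\subseteq V(G)$. The Cartesian product $G\Box H$ has vertex set $V(G)\times V(H)$, with $(g_1,h_1)$ and $(g_2,h_2)$ adjacent iff either $g_1=g_2$ and $h_1h_2\in E(H)$, or $h_1=h_2$ and $g_1g_2\in E(G)$. -}

module Defs where

open import Data.Nat using (ℕ; zero; suc; _+_; _*_; _≤_; _<_)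
import Data.Fin
open import Data.Fin using (Fin; toℕ; remQuot; _≟_)
open import Data.Bool using (Bool; true; false; _∧_; _∨_)
open import Data.Product using (_×_; _,_; Σ; ∃; proj₁; proj₂)
open import Data.Sum using (_⊎_)
open import Data.List using (List; length)
open import Data.List.Membership.Propositional using (_∈_)
open import Data.List.Relation.Unary.All using (All)
open import Data.List.Relation.Unary.Unique.Propositional using (Unique)
open import Relation.Binary.PropositionalEquality using (_≡_)
open import Relation.Binary.Construct.Closure.ReflexiveTransitive using (Star)
open import Relation.Nullary using (¬_)
open import Relation.Nullary.Decidable using (⌊_⌋)

Graph : ℕ → Set
Graph n = Fin n → Fin n → Bool

Adj : ∀ {n} → Graph n → Fin n → Fin n → Set
Adj G u v = G u v ≡ true

IsSimple : ∀ {n} → Graph n → Set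
IsSimple G = (∀ u v → G u v ≡ G v u) × (∀ u → G u u ≡ false)

Connected : ∀ {n} → Graph n → Set
Connected G = ∀ u v → Star (Adj G) u v

-- Cartesian product of two graphs; vertex (g , h) is encoded as combine g h,
-- decoded with remQuot.
_□_ : ∀ {n m} → Graph n → Graph m → Graph (n * m)
_□_ {n} {m} G H x y with remQuot {n} m x | remQuot {n} m y
... | (g₁ , h₁) | (g₂ , h₂) =
  (⌊ g₁ ≟ g₂ ⌋ ∧ H h₁ h₂) ∨ (⌊ h₁ ≟ h₂ ⌋ ∧ G g₁ g₂)

-- the trivial graph K₁ (only used for k = 0, which never occurs in lemma4)
K₁ : Graph 1
K₁ _ _ = false

prodN : (k : ℕ) → (Fin k → ℕ) → ℕ
prodN zero ns = 1
prodN (suc zero) ns = ns Data.Fin.zero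
prodN (suc (suc k)) ns = ns Data.Fin.zero * prodN (suc k) (λ i → ns (Data.Fin.suc i))

prodG : (k : ℕ) (ns : Fin k → ℕ) → ((i : Fin k) → Graph (ns i)) → Graph (prodN k ns)
prodG zero ns G = K₁
prodG (suc zero) ns G = G Data.Fin.zero
prodG (suc (suc k)) ns G =
  G Data.Fin.zero □ prodG (suc k) (λ i → ns (Data.Fin.suc i)) (λ i → G (Data.Fin.suc i))

sumF : (k : ℕ) → (Fin k → ℕ) → ℕ
sumF zero D = 0
sumF (suc k) D = D Data.Fin.zero + sumF k (λ i → D (Data.Fin.suc i))

-- A tree in G: vertex list U (no repetitions), edge list E of edges of G
-- (each unordered edge {u,v} stored once as (u , v) with u < v), endpoints in U,
-- (U , E) connected and |E| = |U| - 1.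
EdgeAdj : ∀ {n} → List (Fin n × Fin n) → Fin n → Fin n → Set
EdgeAdj E u v = ((u , v) ∈ E) ⊎ ((v , u) ∈ E)

record Tree {n : ℕ} (G : Graph n) : Set where
  field
    U     : List (Fin n)
    E     : List (Fin n × Fin n)
    uniqU : Unique U
    uniqE : Unique E
    edges : All (λ e → (toℕ (proj₁ e) < toℕ (proj₂ e)) × Adj G (proj₁ e) (proj₂ e)
                       × (proj₁ e ∈ U) × (proj₂ e ∈ U)) E
    count : length U ≡ suc (length E)
    conn  : ∀ u v → u ∈ U → v ∈ U → Star (EdgeAdj E) u v

size : ∀ {n} {G : Graph n} → Tree G → ℕ
size T = length (Tree.E T)

Contains : ∀ {n} {G : Graph n} → Tree G → Fin n → Fin n → Fin n → Set
Contains T x y z = (x ∈ Tree.U T) × (y ∈ Tree.U T) × (z ∈ Tree.U T)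

IsSteinerDist : ∀ {n} → Graph n → Fin n → Fin n → Fin n → ℕ → Set
IsSteinerDist G x y z d =
  (Σ (Tree G) λ T → Contains T x y z × size T ≡ d)
  × (∀ (T : Tree G) → Contains T x y z → d ≤ size T)

Distinct3 : ∀ {n} → Fin n → Fin n → Fin n → Set
Distinct3 x y z = ¬ (x ≡ y) × ¬ (x ≡ z) × ¬ (y ≡ z)

IsSDiam3 : ∀ {n} → Graph n → ℕ → Set
IsSDiam3 G D =
  (∀ x y z → Distinct3 x y z → ∃ λ d → IsSteinerDist G x y z d × d ≤ D)
  × (∃ λ x → ∃ λ y → ∃ λ z → Distinct3 x y z × IsSteinerDist G x y z D)

module Submission where

-- Trees are handled through growth sequences: vertex lists in which every
-- entry but the last is adjacent to a later entry.  A tree with s edges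
-- through a vertex triple S yields a growth sequence of length at most s + 1
-- through S, and every growth sequence through S yields a tree through S
-- with fewer edges than its length.  Growth sequences of a fixed length are
-- finitely many and decidable, so a shortest one exists; this gives the
-- Steiner distance of every triple lying on some growth sequence.
--
-- For a product G □ H two estimates on growth sequences then suffice:
--   * projection: a growth sequence W of G □ H projects to growth sequences
--     A of G and B of H with |A| + |B| ≤ |W| + 1   (lower bound on d(S));
--   * lifting: growth sequences A, B through the coordinates of three
--     vertices lift to a growth sequence W through the vertices with
--     |W| + 1 ≤ |A| + |B|, by peeling leaves of A and B   (upper bound).
-- Together they give sdiam₃(G □ H) = sdiam₃ G + sdiam₃ H, and the theorem
-- follows by induction on the number of factors.

open import Defs
open import Data.Nat using (ℕ; zero; suc; _+_; _*_; _≤_; _<_; z≤n; s≤s)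
open import Data.Nat.Properties
  using (≤-refl; ≤-reflexive; ≤-trans; ≤-pred; ≤-antisym; ≮⇒≥; +-suc; +-comm; +-mono-≤;
         *-mono-≤; n≤1+n; +-identityʳ; <-cmp; anyUpTo?)
open import Data.Nat.Induction using (<-rec)
open import Data.Fin using (Fin; toℕ; remQuot; combine; _≟_)
import Data.Fin as Fin
open import Data.Fin.Properties
  using (toℕ-injective; remQuot-combine; combine-remQuot; combine-injectiveˡ; ¬∀⟶∃¬)
  renaming (all? to fin-all?; any? to fin-any?)
open import Data.Bool using (Bool; true; false; _∧_; _∨_)
import Data.Bool as Bool
open import Data.Bool.Properties using (∧-zeroʳ; ∨-zeroʳ)
open import Data.Product using (_×_; _,_; ∃; proj₁; proj₂; map₁)
open import Data.Sum using (_⊎_; inj₁; inj₂; swap)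
import Data.Sum as Sum
open import Data.List using (List; []; _∷_; length; map; cartesianProductWith; allFin)
open import Data.List.Properties using (length-map)
open import Data.List.Membership.Propositional using (_∈_; _∉_; find; lose)
open import Data.List.Membership.Propositional.Properties
  using (∈-map⁺; ∈-allFin; ∈-cartesianProductWith⁺; ∈-cartesianProductWith⁻)
open import Data.List.Relation.Binary.Subset.Propositional using (_⊆_)
open import Data.List.Relation.Unary.Any using (here; there; any?)
open import Data.List.Relation.Unary.All using (All; []; _∷_)
import Data.List.Relation.Unary.All as All
open import Data.List.Relation.Unary.All.Properties using (¬Any⇒All¬)
open import Data.List.Relation.Unary.Unique.Propositional using (Unique)
open import Data.List.Relation.Unary.AllPairs using ([]; _∷_)
open import Function using (id; _∘_)
open import Relation.Binary using (tri<; tri≈; tri>)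
open import Relation.Binary.PropositionalEquality
open import Relation.Binary.Construct.Closure.ReflexiveTransitive using (Star; ε; _◅_; _◅◅_)
import Relation.Binary.Construct.Closure.ReflexiveTransitive as Star
open import Relation.Nullary using (Dec; yes; no)
open import Relation.Nullary.Decidable
  using (⌊_⌋; from-yes; decidable-stable; ¬?; _×-dec_; _⊎-dec_; _→-dec_)
open import Relation.Unary using (Decidable)
open import Data.Empty using (⊥-elim)

module _ {A : Set} where

  remove : ∀ {x : A} ys → x ∈ ys → List A
  remove (y ∷ ys) (here _)  = ys
  remove (y ∷ ys) (there p) = y ∷ remove ys p

  length-remove : ∀ {x : A} ys (p : x ∈ ys) → length ys ≡ suc (length (remove ys p))
  length-remove (y ∷ ys) (here _)  = refl
  length-remove (y ∷ ys) (there p) = cong suc (length-remove ys p)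

  ∈-remove : ∀ {x a : A} ys (p : x ∈ ys) → a ∈ ys → a ≢ x → a ∈ remove ys p
  ∈-remove (y ∷ ys) (here refl) (here refl) a≢x = ⊥-elim (a≢x refl)
  ∈-remove (y ∷ ys) (here refl) (there q)   _   = q
  ∈-remove (y ∷ ys) (there p)   (here refl) _   = here refl
  ∈-remove (y ∷ ys) (there p)   (there q)   a≢x = there (∈-remove ys p q a≢x)

  unique-⊆-length : ∀ {xs ys : List A} → Unique xs → xs ⊆ ys → length xs ≤ length ys
  unique-⊆-length {[]}     _            _   = z≤n
  unique-⊆-length {x ∷ xs} {ys} (x∉ ∷ u) sub =
    subst (suc (length xs) ≤_) (sym (length-remove ys x∈))
      (s≤s (unique-⊆-length u λ a∈ → ∈-remove ys x∈ (sub (there a∈)) (All.lookup x∉ a∈ ∘ sym)))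
    where
    x∈ : x ∈ ys
    x∈ = sub (here refl)

least : ∀ {P : ℕ → Set} → Decidable P → ∀ {s} → P s → ∃ λ j → P j × (∀ {i} → P i → j ≤ i)
least {P} P? {s} = <-rec (λ s → P s → ∃ λ j → P j × (∀ {i} → P i → j ≤ i)) search s
  where
  search : ∀ s → (∀ {r} → r < s → P r → ∃ λ j → P j × (∀ {i} → P i → j ≤ i)) →
           P s → ∃ λ j → P j × (∀ {i} → P i → j ≤ i)
  search s smaller ps with anyUpTo? P? s
  ... | yes (r , r<s , pr) = smaller r<s pr
  ... | no none = s , ps , λ {i} pi → ≮⇒≥ (λ i<s → none (i , i<s , pi))

+-suc-suc-≤ : ∀ {a b c} → suc a + suc b ≤ suc (suc c) → a + b ≤ c
+-suc-suc-≤ {a} {b} {c} (s≤s le) = ≤-pred (subst (_≤ suc c) (+-suc a b) le)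

≤-+-suc-suc : ∀ {a b c} → suc (suc c) ≤ suc a + suc b → c ≤ a + b
≤-+-suc-suc {a} {b} {c} (s≤s le) = ≤-pred (subst (suc c ≤_) (+-suc a b) le)

∨-true : ∀ b c → b ∨ c ≡ true → b ≡ true ⊎ c ≡ true
∨-true true  _ _ = inj₁ refl
∨-true false _ e = inj₂ e

∧-true : ∀ b c → b ∧ c ≡ true → b ≡ true × c ≡ true
∧-true true _ e = refl , e

⌊≟⌋-true : ∀ {k} {a c : Fin k} → ⌊ a ≟ c ⌋ ≡ true → a ≡ c
⌊≟⌋-true {a = a} {c} e with a ≟ c
... | yes a≡c = a≡c

⌊≟⌋-refl : ∀ {k} (a : Fin k) → ⌊ a ≟ a ⌋ ≡ true
⌊≟⌋-refl a with a ≟ a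
... | yes _   = refl
... | no  a≢a = ⊥-elim (a≢a refl)

⌊≟⌋-sym : ∀ {k} (a c : Fin k) → ⌊ a ≟ c ⌋ ≡ ⌊ c ≟ a ⌋
⌊≟⌋-sym a c with a ≟ c | c ≟ a
... | yes _   | yes _   = refl
... | no  _   | no  _   = refl
... | yes a≡c | no  c≢a = ⊥-elim (c≢a (sym a≡c))
... | no  a≢c | yes c≡a = ⊥-elim (a≢c (sym c≡a))

avoid-two : ∀ {k} → 3 ≤ k → (p q : Fin k) → ∃ λ r → r ≢ p × r ≢ q
avoid-two {suc zero} (s≤s ()) _ _
avoid-two {suc (suc zero)} (s≤s (s≤s ())) _ _
avoid-two {suc (suc (suc _))} _ Fin.zero Fin.zero             = Fin.suc Fin.zero , (λ ()) , (λ ())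
avoid-two {suc (suc (suc _))} _ Fin.zero (Fin.suc Fin.zero)    = Fin.suc (Fin.suc Fin.zero) , (λ ()) , (λ ())
avoid-two {suc (suc (suc _))} _ Fin.zero (Fin.suc (Fin.suc _)) = Fin.suc Fin.zero , (λ ()) , (λ ())
avoid-two {suc (suc (suc _))} _ (Fin.suc Fin.zero) Fin.zero    = Fin.suc (Fin.suc Fin.zero) , (λ ()) , (λ ())
avoid-two {suc (suc (suc _))} _ (Fin.suc (Fin.suc _)) Fin.zero = Fin.suc Fin.zero , (λ ()) , (λ ())
avoid-two {suc (suc (suc _))} _ (Fin.suc _) (Fin.suc _)        = Fin.zero , (λ ()) , (λ ())

triple : ∀ {A : Set} → A → A → A → Fin 3 → A
triple x y z Fin.zero                     = x
triple x y z (Fin.suc Fin.zero)           = y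
triple x y z (Fin.suc (Fin.suc Fin.zero)) = z

In3 : ∀ {k} → Fin k → Fin k → Fin k → Fin k → Set
In3 v x y z = v ≡ x ⊎ v ≡ y ⊎ v ≡ z

-- Any three vertices (not necessarily distinct) lie in a 3-element set,
-- as sdiam₃ only speaks about 3-element sets.
extend-to-distinct : ∀ {k} → 3 ≤ k → (a b c : Fin k) → ∃ λ x → ∃ λ y → ∃ λ z →
                     Distinct3 x y z × In3 a x y z × In3 b x y z × In3 c x y z
extend-to-distinct h a b c =
  let (y , a≢y , b-in) = second
      (z , a≢z , y≢z , c-in) = third y
  in a , y , z , (a≢y , a≢z , y≢z) , inj₁ refl , Sum.map₂ inj₁ b-in , c-in
  where
  second : ∃ λ y → a ≢ y × (b ≡ a ⊎ b ≡ y)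
  second with b ≟ a
  ... | yes b≡a = let (r , r≢a , _) = avoid-two h a a in r , r≢a ∘ sym , inj₁ b≡a
  ... | no  b≢a = b , b≢a ∘ sym , inj₂ refl
  third : ∀ y → ∃ λ z → a ≢ z × y ≢ z × In3 c a y z
  third y with c ≟ a | c ≟ y
  ... | yes c≡a | _       = let (r , r≢a , r≢y) = avoid-two h a y in r , r≢a ∘ sym , r≢y ∘ sym , inj₁ c≡a
  ... | no  _   | yes c≡y = let (r , r≢a , r≢y) = avoid-two h a y
                            in r , r≢a ∘ sym , r≢y ∘ sym , inj₂ (inj₁ c≡y)
  ... | no  c≢a | no  c≢y = c , c≢a ∘ sym , c≢y ∘ sym , inj₂ (inj₂ refl)

-- Its vertices span a
-- connected subgraph of G; entries may repeat.
data Grown {n} (G : Graph n) : List (Fin n) → Set where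
  one : ∀ x → Grown G (x ∷ [])
  add : ∀ {x y xs} → y ∈ xs → Adj G x y → Grown G xs → Grown G (x ∷ xs)

Through : ∀ {n} → Graph n → Fin n → Fin n → Fin n → List (Fin n) → Set
Through G x y z L = Grown G L × x ∈ L × y ∈ L × z ∈ L

map-Grown : ∀ {n n′} {G : Graph n} {G′ : Graph n′} (f : Fin n → Fin n′) →
            (∀ {u v} → Adj G u v → Adj G′ (f u) (f v)) → ∀ {L} → Grown G L → Grown G′ (map f L)
map-Grown f f-adj (one x)        = one (f x)
map-Grown f f-adj (add y∈ xy gL) = add (∈-map⁺ f y∈) (f-adj xy) (map-Grown f f-adj gL)

module Growth {n : ℕ} (G : Graph n) (G-sym : ∀ u v → G u v ≡ G v u) where

  adj-sym : ∀ {u v} → Adj G u v → Adj G v u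
  adj-sym {u} {v} uv = trans (G-sym v u) uv

  -- Two growth sequences sharing a vertex w merge into one containing both,
  -- with w counted once.  The entries of Y are moved over to Z one by one.
  merge : ∀ {Z Y w} → Grown G Z → Grown G Y → w ∈ Z → w ∈ Y →
          ∃ λ M → Grown G M × Z ⊆ M × Y ⊆ M × (∀ {v} → v ∈ M → v ∈ Z ⊎ v ∈ Y)
                × length M + 1 ≤ length Z + length Y
  merge {Z} gZ (one y) wZ (here refl) = Z , gZ , id , (λ { (here refl) → wZ }) , inj₁ , ≤-refl
  merge {Z} gZ (add {y} {p} {ys} p∈ yp gY) wZ (there wY) =
    let (M , gM , Z⊆M , ys⊆M , M⊆ , len) = merge gZ gY wZ wY in
    y ∷ M , add (ys⊆M p∈) yp gM , there ∘ Z⊆M ,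
    (λ { (here refl) → here refl ; (there q) → there (ys⊆M q) }) ,
    (λ { (here refl) → inj₂ (here refl) ; (there q) → Sum.map₂ there (M⊆ q) }) ,
    subst (suc (length M) + 1 ≤_) (sym (+-suc (length Z) (length ys))) (s≤s len)
  merge {Z} gZ (add {y} {p} {ys} p∈ yp gY) wZ (here refl) =
    let (M , gM , pZ⊆M , ys⊆M , M⊆ , len) = merge (add wZ (adj-sym yp) gZ) gY (here refl) p∈ in
    M , gM , pZ⊆M ∘ there ,
    (λ { (here refl) → pZ⊆M (there wZ) ; (there q) → ys⊆M q }) ,
    (λ q → origin (M⊆ q)) ,
    subst (length M + 1 ≤_) (sym (+-suc (length Z) (length ys))) len
    where
    origin : ∀ {v} → v ∈ p ∷ Z ⊎ v ∈ ys → v ∈ Z ⊎ v ∈ y ∷ ys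
    origin (inj₁ (here refl)) = inj₂ (there p∈)
    origin (inj₁ (there q))   = inj₁ q
    origin (inj₂ q)           = inj₂ (there q)

  walk→grown : ∀ {R : Fin n → Fin n → Set} {P : Fin n → Set} →
               (∀ {u v} → R u v → Adj G u v × P v) → ∀ {a b} → P a → Star R a b →
               ∃ λ L → Grown G L × a ∈ L × b ∈ L × All P L
  walk→grown step {a} pa ε = a ∷ [] , one a , here refl , here refl , pa ∷ []
  walk→grown step {a} pa (r ◅ rs) =
    let (L , gL , c∈ , b∈ , all-P) = walk→grown step (proj₂ (step r)) rs in
    a ∷ L , add c∈ (proj₁ (step r)) gL , here refl , there b∈ , pa ∷ all-P

  open import Data.List.Membership.DecPropositional (_≟_ {n}) using (_∈?_)

  nub : ∀ {L} → Grown G L → ∃ λ L′ → Grown G L′ × Unique L′ × L ⊆ L′ × L′ ⊆ L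
  nub (one x) = x ∷ [] , one x , [] ∷ [] , id , id
  nub (add {x} {y} y∈ xy gL) with nub gL
  ... | L′ , gL′ , uL′ , L⊆ , ⊆L with x ∈? L′
  ...   | yes x∈ = L′ , gL′ , uL′ , (λ { (here refl) → x∈ ; (there q) → L⊆ q }) , there ∘ ⊆L
  ...   | no  x∉ = x ∷ L′ , add (L⊆ y∈) xy gL′ , ¬Any⇒All¬ L′ x∉ ∷ uL′ ,
                   (λ { (here refl) → here refl ; (there q) → there (L⊆ q) }) ,
                   (λ { (here refl) → here refl ; (there q) → there (⊆L q) })

  TreeEdge : List (Fin n) → Fin n × Fin n → Set
  TreeEdge U e = (toℕ (proj₁ e) < toℕ (proj₂ e)) × Adj G (proj₁ e) (proj₂ e)
                × (proj₁ e ∈ U) × (proj₂ e ∈ U)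

  record TreeOn (L : List (Fin n)) : Set where
    field
      E     : List (Fin n × Fin n)
      uniqE : Unique E
      edges : All (TreeEdge L) E
      count : length L ≡ suc (length E)
      conn  : ∀ u v → u ∈ L → v ∈ L → Star (EdgeAdj E) u v

  orient : ∀ {x y} → x ≢ y → Adj G x y →
           ∃ λ e → (toℕ (proj₁ e) < toℕ (proj₂ e)) × Adj G (proj₁ e) (proj₂ e)
                 × (e ≡ (x , y) ⊎ e ≡ (y , x))
  orient {x} {y} x≢y xy with <-cmp (toℕ x) (toℕ y)
  ... | tri< x<y _ _ = (x , y) , x<y , xy , inj₁ refl
  ... | tri≈ _ x≡y _ = ⊥-elim (x≢y (toℕ-injective x≡y))
  ... | tri> _ _ y<x = (y , x) , y<x , adj-sym xy , inj₂ refl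

  attach-leaf : ∀ {x y xs} → y ∈ xs → Adj G x y → x ∉ xs → TreeOn xs → TreeOn (x ∷ xs)
  attach-leaf {x} {y} {xs} y∈ xy x∉ T with orient (λ { refl → x∉ y∈ }) xy
  ... | e , e-ord , e-adj , e-ends = record
    { E     = e ∷ E
    ; uniqE = All.map (new≢old e-ends) edges ∷ uniqE
    ; edges = (e-ord , e-adj , new-ends e-ends) ∷ All.map (λ (o , a , p , q) → o , a , there p , there q) edges
    ; count = cong suc count
    ; conn  = conn′
    }
    where
    open TreeOn T
    new-ends : ∀ {e} → e ≡ (x , y) ⊎ e ≡ (y , x) → proj₁ e ∈ x ∷ xs × proj₂ e ∈ x ∷ xs
    new-ends (inj₁ refl) = here refl , there y∈
    new-ends (inj₂ refl) = there y∈ , here refl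
    new≢old : ∀ {e e′} → e ≡ (x , y) ⊎ e ≡ (y , x) → TreeEdge xs e′ → e ≢ e′
    new≢old (inj₁ refl) (_ , _ , p , _) refl = x∉ p
    new≢old (inj₂ refl) (_ , _ , _ , q) refl = x∉ q
    x→y : ∀ {e} → e ≡ (x , y) ⊎ e ≡ (y , x) → EdgeAdj (e ∷ E) x y
    x→y (inj₁ refl) = inj₁ (here refl)
    x→y (inj₂ refl) = inj₂ (here refl)
    old : ∀ {u v} → Star (EdgeAdj E) u v → Star (EdgeAdj (e ∷ E)) u v
    old = Star.map (Sum.map there there)
    conn′ : ∀ u v → u ∈ x ∷ xs → v ∈ x ∷ xs → Star (EdgeAdj (e ∷ E)) u v
    conn′ _ _ (here refl) (here refl) = ε
    conn′ _ v (here refl) (there q)   = x→y e-ends ◅ old (conn y v y∈ q)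
    conn′ u _ (there p)   (here refl) = old (conn u y p y∈) ◅◅ (swap (x→y e-ends) ◅ ε)
    conn′ u v (there p)   (there q)   = old (conn u v p q)

  spanning-tree : ∀ {L} → Grown G L → Unique L → TreeOn L
  spanning-tree (one x) _ = record
    { E = [] ; uniqE = [] ; edges = [] ; count = refl ; conn = λ { _ _ (here refl) (here refl) → ε } }
  spanning-tree (add y∈ xy gL) (x≢ ∷ uL) =
    attach-leaf y∈ xy (λ x∈ → All.lookup x≢ x∈ refl) (spanning-tree gL uL)

  grown→tree : ∀ {x y z L} → Through G x y z L →
               ∃ λ (T : Tree G) → Contains T x y z × suc (size T) ≤ length L
  grown→tree {L = L} (gL , xL , yL , zL) with nub gL
  ... | L′ , gL′ , uL′ , L⊆ , ⊆L =
    T , (L⊆ xL , L⊆ yL , L⊆ zL) , subst (_≤ length L) (TreeOn.count tree) (unique-⊆-length uL′ ⊆L)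
    where
    tree : TreeOn L′
    tree = spanning-tree gL′ uL′
    T : Tree G
    T = record { U = L′ ; E = TreeOn.E tree ; uniqU = uL′ ; uniqE = TreeOn.uniqE tree
               ; edges = TreeOn.edges tree ; count = TreeOn.count tree ; conn = TreeOn.conn tree }

  tree-step : (T : Tree G) → ∀ {u v} → EdgeAdj (Tree.E T) u v → Adj G u v × v ∈ Tree.U T
  tree-step T (inj₁ e∈) = let (_ , uv , _ , v∈) = All.lookup (Tree.edges T) e∈ in uv , v∈
  tree-step T (inj₂ e∈) = let (_ , vu , v∈ , _) = All.lookup (Tree.edges T) e∈ in adj-sym vu , v∈

  -- Conversely, a tree with s edges through x, y, z gives a growth sequence
  -- through x, y, z of length at most s + 1: merge the tree paths x–y, x–z.
  tree→grown : (T : Tree G) → ∀ {x y z} → Contains T x y z →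
               ∃ λ L → Through G x y z L × length L ≤ suc (size T)
  tree→grown T {x} {y} {z} (xU , yU , zU)
    with walk→grown (tree-step T) xU (Tree.conn T x y xU yU)
       | walk→grown (tree-step T) xU (Tree.conn T x z xU zU)
  ... | L₁ , g₁ , x₁ , y₁ , L₁⊆U | L₂ , g₂ , x₂ , z₂ , L₂⊆U with merge g₁ g₂ x₁ x₂
  ... | M , gM , L₁⊆M , L₂⊆M , M⊆ , _ with nub gM
  ... | L , gL , uL , M⊆L , L⊆M =
    L , (gL , M⊆L (L₁⊆M x₁) , M⊆L (L₁⊆M y₁) , M⊆L (L₂⊆M z₂)) ,
    subst (length L ≤_) (Tree.count T) (unique-⊆-length uL (in-tree ∘ M⊆ ∘ L⊆M))
    where
    in-tree : ∀ {v} → v ∈ L₁ ⊎ v ∈ L₂ → v ∈ Tree.U T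
    in-tree (inj₁ v∈) = All.lookup L₁⊆U v∈
    in-tree (inj₂ v∈) = All.lookup L₂⊆U v∈

  grown? : ∀ L → Dec (Grown G L)
  grown? []           = no λ ()
  grown? (x ∷ [])     = yes (one x)
  grown? (x ∷ y ∷ ys) with grown? (y ∷ ys) | any? (λ w → G x w Bool.≟ true) (y ∷ ys)
  ... | yes g  | yes a = let (w , w∈ , xw) = find a in yes (add w∈ xw g)
  ... | no ¬g  | _     = no λ { (add _ _ g) → ¬g g }
  ... | _      | no ¬a = no λ { (add w∈ xw _) → ¬a (lose w∈ xw) }

  through? : ∀ x y z L → Dec (Through G x y z L)
  through? x y z L = grown? L ×-dec x ∈? L ×-dec y ∈? L ×-dec z ∈? L

  lists : ℕ → List (List (Fin n))
  lists zero    = [] ∷ []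
  lists (suc j) = cartesianProductWith _∷_ (allFin n) (lists j)

  lists-complete : ∀ L → L ∈ lists (length L)
  lists-complete []      = here refl
  lists-complete (x ∷ L) = ∈-cartesianProductWith⁺ _∷_ (∈-allFin x) (lists-complete L)

  lists-length : ∀ j {L} → L ∈ lists j → length L ≡ j
  lists-length zero    (here refl) = refl
  lists-length (suc j) L∈ with ∈-cartesianProductWith⁻ _∷_ (allFin n) (lists j) L∈
  ... | _ , _ , _ , L′∈ , refl = cong suc (lists-length j L′∈)

  -- Every triple on a growth sequence L₀ has a Steiner distance d < |L₀|:
  -- take a shortest growth sequence through the triple and its spanning tree.
  steiner-distance : ∀ {x y z L₀} → Through G x y z L₀ → ∃ λ d → IsSteinerDist G x y z d × d < length L₀
  steiner-distance {x} {y} {z} {L₀} th₀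
    with least (λ j → any? (through? x y z) (lists j)) {length L₀} (lose (lists-complete L₀) th₀)
  ... | j , j-ok , j-least with find j-ok
  ... | L , L∈ , th with grown→tree th
  ... | T , c , T<L = size T , ((T , c , refl) , optimal) , ≤-trans T<j (j-least (lose (lists-complete L₀) th₀))
    where
    T<j : suc (size T) ≤ j
    T<j = subst (suc (size T) ≤_) (lists-length j L∈) T<L
    optimal : ∀ (T′ : Tree G) → Contains T′ x y z → size T ≤ size T′
    optimal T′ c′ with tree→grown T′ c′
    ... | L′ , th′ , L′≤T′ =
      ≤-pred (≤-trans T<j (≤-trans (j-least (lose (lists-complete L′) th′)) L′≤T′))

-- If sdiam₃ G = D, then any three vertices of G lie on a growth sequence of
-- length at most D + 1 (extend them to a 3-element set first).
cover : ∀ {k} {G : Graph k} → (∀ u v → G u v ≡ G v u) → 3 ≤ k → ∀ {D} → IsSDiam3 G D →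
        (t : Fin 3 → Fin k) → ∃ λ A → Grown G A × (∀ i → t i ∈ A) × length A ≤ suc D
cover G-sym h (bounded , _) t
  with extend-to-distinct h (t Fin.zero) (t (Fin.suc Fin.zero)) (t (Fin.suc (Fin.suc Fin.zero)))
... | x , y , z , distinct , t₀ , t₁ , t₂ with bounded x y z distinct
... | d , ((T , c , refl) , _) , d≤D with Growth.tree→grown _ G-sym T c
... | L , (gL , xL , yL , zL) , L≤T = L , gL , on-L , ≤-trans L≤T (s≤s d≤D)
  where
  In3-∈ : ∀ {v} → In3 v x y z → v ∈ L
  In3-∈ (inj₁ refl)        = xL
  In3-∈ (inj₂ (inj₁ refl)) = yL
  In3-∈ (inj₂ (inj₂ refl)) = zL
  on-L : ∀ i → t i ∈ L
  on-L Fin.zero                      = In3-∈ t₀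
  on-L (Fin.suc Fin.zero)            = In3-∈ t₁
  on-L (Fin.suc (Fin.suc Fin.zero))  = In3-∈ t₂

Fin3-exhausted : (i j m x : Fin 3) → i ≢ j → i ≢ m → j ≢ m → In3 x i j m
Fin3-exhausted = from-yes
  (fin-all? {3} λ i → fin-all? {3} λ j → fin-all? {3} λ m → fin-all? {3} λ x →
     ¬? (i ≟ j) →-dec (¬? (i ≟ m) →-dec (¬? (j ≟ m) →-dec ((x ≟ i) ⊎-dec ((x ≟ j) ⊎-dec (x ≟ m))))))

-- Position of three points (t i , u i) of a product relative to a vertex a
-- of the first factor and a vertex b of the second; it decides which leaf
-- is peeled when lifting growth sequences.
data Position {n m} (t : Fin 3 → Fin n) (u : Fin 3 → Fin m) (a : Fin n) (b : Fin m) : Set where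
  on-cross    : (∀ i → t i ≡ a ⊎ u i ≡ b) → Position t u a b
  row-thin    : (∀ i j → u i ≡ b → u j ≡ b → t i ≡ t j) → Position t u a b
  column-thin : (∀ i j → t i ≡ a → t j ≡ a → u i ≡ u j) → Position t u a b

-- Every configuration has a position: unless the row is thin, it holds two
-- points with different first coordinates; if moreover some point is off the
-- cross, these are all three points, so every point of the column lies in the
-- row and the column is thin.
position : ∀ {n m} (t : Fin 3 → Fin n) (u : Fin 3 → Fin m) a b → Position t u a b
position t u a b with fin-any? (λ i → fin-any? λ j → (u i ≟ b) ×-dec ((u j ≟ b) ×-dec ¬? (t i ≟ t j)))
... | no ¬wide = row-thin λ i j ui uj → decidable-stable (t i ≟ t j) (λ ne → ¬wide (i , j , ui , uj , ne))
... | yes (i , j , ui , uj , ti≢tj) with fin-all? (λ k → (t k ≟ a) ⊎-dec (u k ≟ b))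
...   | yes on = on-cross on
...   | no off with ¬∀⟶∃¬ 3 _ (λ k → (t k ≟ a) ⊎-dec (u k ≟ b)) off
...     | m₀ , m₀-off = column-thin λ k l tk tl → trans (in-row k tk) (sym (in-row l tl))
  where
  in-row : ∀ k → t k ≡ a → u k ≡ b
  in-row k tk with Fin3-exhausted i j m₀ k (λ { refl → ti≢tj refl })
                                            (λ { refl → m₀-off (inj₂ ui) }) (λ { refl → m₀-off (inj₂ uj) })
  ... | inj₁ refl        = ui
  ... | inj₂ (inj₁ refl) = uj
  ... | inj₂ (inj₂ refl) = ⊥-elim (m₀-off (inj₁ tk))

-- case analysis on a position; lifting uses it in place of pattern matching
-- so that its recursion is visibly structural
position-cases : ∀ {n m} {t : Fin 3 → Fin n} {u : Fin 3 → Fin m} {a b} {P : Set} → Position t u a b →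
                 ((∀ i → t i ≡ a ⊎ u i ≡ b) → P) →
                 ((∀ i j → u i ≡ b → u j ≡ b → t i ≡ t j) → P) →
                 ((∀ i j → t i ≡ a → t j ≡ a → u i ≡ u j) → P) → P
position-cases (on-cross cross)   on-cross-case _             _                = on-cross-case cross
position-cases (row-thin thin)    _             row-thin-case _                = row-thin-case thin
position-cases (column-thin thin) _             _             column-thin-case = column-thin-case thin

-- v with b replaced by y; moves points off a peeled leaf b to its neighbour y
redirect : ∀ {k} (b y v : Fin k) → Fin k
redirect b y v with v ≟ b
... | yes _ = y
... | no  _ = v

redirect-leaf : ∀ {k} {b y v : Fin k} → v ≡ b → redirect b y v ≡ y
redirect-leaf {b = b} {v = v} v≡b with v ≟ b
... | yes _   = refl
... | no  v≢b = ⊥-elim (v≢b v≡b)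

redirect-other : ∀ {k} {b y v : Fin k} → v ≢ b → redirect b y v ≡ v
redirect-other {b = b} {v = v} v≢b with v ≟ b
... | yes v≡b = ⊥-elim (v≢b v≡b)
... | no  _   = refl

redirect-∈ : ∀ {k} {b y v : Fin k} {bs} → y ∈ bs → v ∈ b ∷ bs → redirect b y v ∈ bs
redirect-∈ {b = b} {v = v} y∈ v∈ with v ≟ b
... | yes _ = y∈
redirect-∈ y∈ (here v≡b) | no v≢b = ⊥-elim (v≢b v≡b)
redirect-∈ y∈ (there v∈) | no _   = v∈

module Product {n m : ℕ} (G : Graph n) (H : Graph m) (G-simple : IsSimple G) (H-simple : IsSimple H) where

  π₁ : Fin (n * m) → Fin n
  π₁ v = proj₁ (remQuot {n} m v)

  π₂ : Fin (n * m) → Fin m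
  π₂ v = proj₂ (remQuot {n} m v)

  π₁-combine : ∀ a b → π₁ (combine a b) ≡ a
  π₁-combine a b = cong proj₁ (remQuot-combine {n} {m} a b)

  π₂-combine : ∀ a b → π₂ (combine a b) ≡ b
  π₂-combine a b = cong proj₂ (remQuot-combine {n} {m} a b)

  combine-π : ∀ v → combine (π₁ v) (π₂ v) ≡ v
  combine-π = combine-remQuot {n} m

  _∼_ : Fin n × Fin m → Fin n × Fin m → Bool
  (g₁ , h₁) ∼ (g₂ , h₂) = (⌊ g₁ ≟ g₂ ⌋ ∧ H h₁ h₂) ∨ (⌊ h₁ ≟ h₂ ⌋ ∧ G g₁ g₂)

  □-unfold : ∀ v w → (G □ H) v w ≡ remQuot {n} m v ∼ remQuot {n} m w
  □-unfold v w with remQuot {n} m v | remQuot {n} m w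
  ... | _ | _ = refl

  ∼-sym : ∀ p q → p ∼ q ≡ q ∼ p
  ∼-sym (a , b) (c , d)
    rewrite proj₁ G-simple a c | proj₁ H-simple b d | ⌊≟⌋-sym a c | ⌊≟⌋-sym b d = refl

  ∼-irrefl : ∀ p → p ∼ p ≡ false
  ∼-irrefl (a , b)
    rewrite proj₂ G-simple a | proj₂ H-simple b | ∧-zeroʳ ⌊ a ≟ a ⌋ | ∧-zeroʳ ⌊ b ≟ b ⌋ = refl

  simple : IsSimple (G □ H)
  simple = (λ v w → trans (□-unfold v w) (trans (∼-sym (remQuot {n} m v) (remQuot {n} m w)) (sym (□-unfold w v))))
         , (λ v → trans (□-unfold v v) (∼-irrefl (remQuot {n} m v)))

  decode∼ : ∀ p q → p ∼ q ≡ true →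
            (proj₁ p ≡ proj₁ q × Adj H (proj₂ p) (proj₂ q))
            ⊎ (proj₂ p ≡ proj₂ q × Adj G (proj₁ p) (proj₁ q))
  decode∼ (a , b) (c , d) pq =
    Sum.map (map₁ ⌊≟⌋-true ∘ ∧-true _ _) (map₁ ⌊≟⌋-true ∘ ∧-true _ _)
            (∨-true (⌊ a ≟ c ⌋ ∧ H b d) _ pq)

  decode : ∀ {v w} → Adj (G □ H) v w →
           (π₁ v ≡ π₁ w × Adj H (π₂ v) (π₂ w)) ⊎ (π₂ v ≡ π₂ w × Adj G (π₁ v) (π₁ w))
  decode {v} {w} vw = decode∼ (remQuot {n} m v) (remQuot {n} m w) (trans (sym (□-unfold v w)) vw)

  adj-column : ∀ a {b b′} → Adj H b b′ → Adj (G □ H) (combine a b) (combine a b′)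
  adj-column a {b} {b′} bb′ = trans (□-unfold (combine a b) (combine a b′))
    (subst₂ (λ p q → p ∼ q ≡ true) (sym (remQuot-combine {n} {m} a b)) (sym (remQuot-combine {n} {m} a b′))
            (cong₂ _∨_ (cong₂ _∧_ (⌊≟⌋-refl a) bb′) refl))

  adj-row : ∀ b {a a′} → Adj G a a′ → Adj (G □ H) (combine a b) (combine a′ b)
  adj-row b {a} {a′} aa′ = trans (□-unfold (combine a b) (combine a′ b))
    (subst₂ (λ p q → p ∼ q ≡ true) (sym (remQuot-combine {n} {m} a b)) (sym (remQuot-combine {n} {m} a′ b))
            (trans (cong₂ _∨_ refl (cong₂ _∧_ (⌊≟⌋-refl b) aa′)) (∨-zeroʳ _)))

  module GG = Growth G (proj₁ G-simple)
  module HH = Growth H (proj₁ H-simple)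
  module PP = Growth (G □ H) (proj₁ simple)

  -- Projection: a growth sequence W of G □ H projects to growth sequences of
  -- the factors of total length at most |W| + 1, since each new entry of W
  -- extends exactly one of the two projections.
  project : ∀ {W} → Grown (G □ H) W → ∃ λ A → ∃ λ B → Grown G A × Grown H B
            × (∀ {v} → v ∈ W → π₁ v ∈ A) × (∀ {v} → v ∈ W → π₂ v ∈ B)
            × length A + length B ≤ suc (length W)
  project (one v) = π₁ v ∷ [] , π₂ v ∷ [] , one (π₁ v) , one (π₂ v) ,
    (λ { (here refl) → here refl }) , (λ { (here refl) → here refl }) , ≤-refl
  project (add {v} {w} {ws} w∈ vw gW) with project gW | decode vw
  ... | A , B , gA , gB , W→A , W→B , len | inj₁ (same₁ , adj₂) =
    A , π₂ v ∷ B , gA , add (W→B w∈) adj₂ gB ,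
    (λ { (here refl) → subst (_∈ A) (sym same₁) (W→A w∈) ; (there q) → W→A q }) ,
    (λ { (here refl) → here refl ; (there q) → there (W→B q) }) ,
    subst (_≤ suc (suc (length ws))) (sym (+-suc (length A) (length B))) (s≤s len)
  ... | A , B , gA , gB , W→A , W→B , len | inj₂ (same₂ , adj₁) =
    π₁ v ∷ A , B , add (W→A w∈) adj₁ gA , gB ,
    (λ { (here refl) → here refl ; (there q) → there (W→A q) }) ,
    (λ { (here refl) → subst (_∈ B) (sym same₂) (W→B w∈) ; (there q) → W→B q }) ,
    s≤s len

  lower-bound : ∀ {x₁ y₁ z₁ x₂ y₂ z₂ d₁ d₂} → IsSteinerDist G x₁ y₁ z₁ d₁ → IsSteinerDist H x₂ y₂ z₂ d₂ →
                (T : Tree (G □ H)) → Contains T (combine x₁ x₂) (combine y₁ y₂) (combine z₁ z₂) →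
                d₁ + d₂ ≤ size T
  lower-bound {d₁ = d₁} {d₂} (_ , optimal₁) (_ , optimal₂) T c with PP.tree→grown T c
  ... | W , (gW , xW , yW , zW) , W≤T with project gW
  ... | A , B , gA , gB , W→A , W→B , AB≤W =
    +-suc-suc-≤ (≤-trans (+-mono-≤ d₁<A d₂<B) (≤-trans AB≤W (s≤s W≤T)))
    where
    first : ∀ {a b} → combine a b ∈ W → a ∈ A
    first {a} {b} p = subst (_∈ A) (π₁-combine a b) (W→A p)
    second : ∀ {a b} → combine a b ∈ W → b ∈ B
    second {a} {b} p = subst (_∈ B) (π₂-combine a b) (W→B p)
    d₁<A : suc d₁ ≤ length A
    d₁<A = let (T₁ , c₁ , T₁<A) = GG.grown→tree (gA , first xW , first yW , first zW)
           in ≤-trans (s≤s (optimal₁ T₁ c₁)) T₁<A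
    d₂<B : suc d₂ ≤ length B
    d₂<B = let (T₂ , c₂ , T₂<B) = HH.grown→tree (gB , second xW , second yW , second zW)
           in ≤-trans (s≤s (optimal₂ T₂ c₂)) T₂<B

  Lifted : (Fin 3 → Fin n) → (Fin 3 → Fin m) → ℕ → Set
  Lifted t u ℓ = ∃ λ W → Grown (G □ H) W × (∀ i → combine (t i) (u i) ∈ W) × suc (length W) ≤ ℓ

  row : ∀ b {A} → Grown G A → Grown (G □ H) (map (λ a → combine a b) A)
  row b = map-Grown (λ a → combine a b) (adj-row b)

  column : ∀ a {B} → Grown H B → Grown (G □ H) (map (combine a) B)
  column a = map-Grown (combine a) (adj-column a)

  lift-row : ∀ {A} b → Grown G A → ∀ t u → (∀ i → t i ∈ A) → (∀ i → u i ∈ b ∷ []) →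
             Lifted t u (length A + 1)
  lift-row {A} b gA t u tA uB =
    _ , row b gA , on-row , ≤-reflexive (trans (cong suc (length-map _ A)) (+-comm 1 (length A)))
    where
    on-row : ∀ i → combine (t i) (u i) ∈ map (λ a → combine a b) A
    on-row i with uB i
    ... | here ui≡b = subst (λ v → combine (t i) v ∈ _) (sym ui≡b) (∈-map⁺ (λ a → combine a b) (tA i))

  lift-column : ∀ {B} a → Grown H B → ∀ t u → (∀ i → t i ∈ a ∷ []) → (∀ i → u i ∈ B) →
                Lifted t u (1 + length B)
  lift-column {B} a gB t u tA uB = _ , column a gB , on-column , ≤-reflexive (cong suc (length-map _ B))
    where
    on-column : ∀ i → combine (t i) (u i) ∈ map (combine a) B
    on-column i with tA i
    ... | here ti≡a = subst (λ g → combine g (u i) ∈ _) (sym ti≡a) (∈-map⁺ (combine a) (uB i))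

  lift-cross : ∀ {a b as bs} → Grown G (a ∷ as) → Grown H (b ∷ bs) → ∀ t u →
               (∀ i → t i ∈ a ∷ as) → (∀ i → u i ∈ b ∷ bs) → (∀ i → t i ≡ a ⊎ u i ≡ b) →
               Lifted t u (length (a ∷ as) + length (b ∷ bs))
  lift-cross {a} {b} {as} {bs} gA gB t u tA uB cross with PP.merge (row b gA) (column a gB) (here refl) (here refl)
  ... | M , gM , row⊆M , column⊆M , _ , len = M , gM , on-M , bound
    where
    on-M : ∀ i → combine (t i) (u i) ∈ M
    on-M i with cross i
    ... | inj₁ ti≡a = column⊆M (subst (λ g → combine g (u i) ∈ _) (sym ti≡a) (∈-map⁺ (combine a) (uB i)))
    ... | inj₂ ui≡b =
      row⊆M (subst (λ v → combine (t i) v ∈ _) (sym ui≡b) (∈-map⁺ (λ g → combine g b) (tA i)))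
    bound : suc (length M) ≤ length (a ∷ as) + length (b ∷ bs)
    bound = subst₂ (λ p q → suc (length M) ≤ p + q)
                   (length-map (λ g → combine g b) (a ∷ as)) (length-map (combine a) (b ∷ bs))
                   (subst (_≤ length (map (λ g → combine g b) (a ∷ as)) + length (map (combine a) (b ∷ bs)))
                          (+-comm (length M) 1) len)

  -- Peeling the leaf b of B, attached to y: if the points of row b share
  -- their first coordinate, a lifting of the points moved from b to y extends
  -- by at most the one vertex (t i₀ , b) attached to (t i₀ , y).
  peel-B : ∀ {b y} → Adj H b y → ∀ t u → (∀ i j → u i ≡ b → u j ≡ b → t i ≡ t j) →
           ∀ {ℓ} → Lifted t (redirect b y ∘ u) ℓ → Lifted t u (suc ℓ)
  peel-B {b} {y} by t u thin (W , gW , on-W , W<ℓ) with fin-any? (λ i → u i ≟ b)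
  ... | no none = W , gW , unmoved , ≤-trans W<ℓ (n≤1+n _)
    where
    unmoved : ∀ i → combine (t i) (u i) ∈ W
    unmoved i = subst (λ v → combine (t i) v ∈ W) (redirect-other (λ ui≡b → none (i , ui≡b))) (on-W i)
  ... | yes (i₀ , ui₀≡b) = combine (t i₀) b ∷ W , add attached (adj-column (t i₀) by) gW , on-W′ , s≤s W<ℓ
    where
    attached : combine (t i₀) y ∈ W
    attached = subst (λ v → combine (t i₀) v ∈ W) (redirect-leaf ui₀≡b) (on-W i₀)
    on-W′ : ∀ i → combine (t i) (u i) ∈ combine (t i₀) b ∷ W
    on-W′ i with u i ≟ b
    ... | yes ui≡b = here (cong₂ combine (thin i i₀ ui≡b ui₀≡b) ui≡b)
    ... | no  ui≢b = there (subst (λ v → combine (t i) v ∈ W) (redirect-other ui≢b) (on-W i))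

  peel-A : ∀ {a x} → Adj G a x → ∀ t u → (∀ i j → t i ≡ a → t j ≡ a → u i ≡ u j) →
           ∀ {ℓ} → Lifted (redirect a x ∘ t) u ℓ → Lifted t u (suc ℓ)
  peel-A {a} {x} ax t u thin (W , gW , on-W , W<ℓ) with fin-any? (λ i → t i ≟ a)
  ... | no none = W , gW , unmoved , ≤-trans W<ℓ (n≤1+n _)
    where
    unmoved : ∀ i → combine (t i) (u i) ∈ W
    unmoved i = subst (λ g → combine g (u i) ∈ W) (redirect-other (λ ti≡a → none (i , ti≡a))) (on-W i)
  ... | yes (i₀ , ti₀≡a) = combine a (u i₀) ∷ W , add attached (adj-row (u i₀) ax) gW , on-W′ , s≤s W<ℓ
    where
    attached : combine x (u i₀) ∈ W
    attached = subst (λ g → combine g (u i₀) ∈ W) (redirect-leaf ti₀≡a) (on-W i₀)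
    on-W′ : ∀ i → combine (t i) (u i) ∈ combine a (u i₀) ∷ W
    on-W′ i with t i ≟ a
    ... | yes ti≡a = here (cong₂ combine ti≡a (thin i i₀ ti≡a ti₀≡a))
    ... | no  ti≢a = there (subst (λ g → combine g (u i) ∈ W) (redirect-other ti≢a) (on-W i))

  -- Lifting: growth sequences A, B through the coordinates of three points
  -- give a growth sequence through the points of length at most |A| + |B| - 1.
  -- Induction on A and B; the position of the points decides which leaf to peel.
  lift : ∀ {A B} → Grown G A → Grown H B → ∀ t u → (∀ i → t i ∈ A) → (∀ i → u i ∈ B) →
         Lifted t u (length A + length B)
  lift gA (one b) t u tA uB = lift-row b gA t u tA uB
  lift (one a) gB t u tA uB = lift-column a gB t u tA uB
  lift gA@(add {a} {x} {as} x∈ ax gas) gB@(add {b} {y} {bs} y∈ by gbs) t u tA uB =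
    position-cases (position t u a b)
      (lift-cross gA gB t u tA uB)
      (λ thin → subst (Lifted t u) (sym (+-suc (length (a ∷ as)) (length bs)))
                  (peel-B by t u thin (lift gA gbs t _ tA (λ i → redirect-∈ y∈ (uB i)))))
      (λ thin → peel-A ax t u thin (lift gas gB _ u (λ i → redirect-∈ x∈ (tA i)) uB))

  -- Upper bound: every triple S of G □ H has d(S) ≤ sdiam₃ G + sdiam₃ H; cover
  -- the coordinate triples of S and lift the covering growth sequences.
  upper-bound : 3 ≤ n → 3 ≤ m → ∀ {D₁ D₂} → IsSDiam3 G D₁ → IsSDiam3 H D₂ →
                ∀ x y z → ∃ λ d → IsSteinerDist (G □ H) x y z d × d ≤ D₁ + D₂
  upper-bound n≥3 m≥3 sd₁ sd₂ x y z
    with cover (proj₁ G-simple) n≥3 sd₁ (π₁ ∘ triple x y z)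
       | cover (proj₁ H-simple) m≥3 sd₂ (π₂ ∘ triple x y z)
  ... | A , gA , on-A , A≤D₁ | B , gB , on-B , B≤D₂ with lift gA gB _ _ on-A on-B
  ... | W , gW , on-W , W<AB =
    let (d , sd , d<W) = PP.steiner-distance (gW , point Fin.zero , point (Fin.suc Fin.zero)
                                                 , point (Fin.suc (Fin.suc Fin.zero)))
    in d , sd , ≤-+-suc-suc (≤-trans (s≤s d<W) (≤-trans W<AB (+-mono-≤ A≤D₁ B≤D₂)))
    where
    point : ∀ i → triple x y z i ∈ W
    point i = subst (_∈ W) (combine-π (triple x y z i)) (on-W i)

  -- sdiam₃(G □ H) = sdiam₃ G + sdiam₃ H: the upper bound holds for all triples,
  -- and combining extremal triples of the factors attains it by the lower bound.
  sdiam-□ : 3 ≤ n → 3 ≤ m → ∀ {D₁ D₂} → IsSDiam3 G D₁ → IsSDiam3 H D₂ → IsSDiam3 (G □ H) (D₁ + D₂)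
  sdiam-□ n≥3 m≥3 {D₁} {D₂} sd₁ sd₂ =
    (λ x y z _ → upper-bound n≥3 m≥3 sd₁ sd₂ x y z) , extremal (proj₂ sd₁) (proj₂ sd₂)
    where
    extremal : (∃ λ x → ∃ λ y → ∃ λ z → Distinct3 x y z × IsSteinerDist G x y z D₁) →
               (∃ λ x → ∃ λ y → ∃ λ z → Distinct3 x y z × IsSteinerDist H x y z D₂) →
               ∃ λ x → ∃ λ y → ∃ λ z → Distinct3 x y z × IsSteinerDist (G □ H) x y z (D₁ + D₂)
    extremal (x₁ , y₁ , z₁ , (x≢y , x≢z , y≢z) , sd₁′) (x₂ , y₂ , z₂ , _ , sd₂′) =
      X , Y , Z ,
      (x≢y ∘ combine-injectiveˡ x₁ x₂ y₁ y₂ , x≢z ∘ combine-injectiveˡ x₁ x₂ z₁ z₂ ,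
       y≢z ∘ combine-injectiveˡ y₁ y₂ z₁ z₂) ,
      attained (upper-bound n≥3 m≥3 sd₁ sd₂ X Y Z)
      where
      X Y Z : Fin (n * m)
      X = combine x₁ x₂
      Y = combine y₁ y₂
      Z = combine z₁ z₂
      attained : (∃ λ d → IsSteinerDist (G □ H) X Y Z d × d ≤ D₁ + D₂) →
                 IsSteinerDist (G □ H) X Y Z (D₁ + D₂)
      attained (d , sd , d≤D) = subst (IsSteinerDist (G □ H) X Y Z) (≤-antisym d≤D D≤d) sd
        where
        D≤d : D₁ + D₂ ≤ d
        D≤d = let ((T , c , T≡d) , _) = sd in subst (D₁ + D₂ ≤_) T≡d (lower-bound sd₁′ sd₂′ T c)

sdiam-prodG : ∀ k (ns : Fin (suc k) → ℕ) (G : (i : Fin (suc k)) → Graph (ns i)) →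
              (∀ i → IsSimple (G i)) → (∀ i → 3 ≤ ns i) →
              (D : Fin (suc k) → ℕ) → (∀ i → IsSDiam3 (G i) (D i)) →
              IsSimple (prodG (suc k) ns G) × 3 ≤ prodN (suc k) ns × IsSDiam3 (prodG (suc k) ns G) (sumF (suc k) D)
sdiam-prodG zero ns G simple ≥3 D sd =
  simple Fin.zero , ≥3 Fin.zero , subst (IsSDiam3 (G Fin.zero)) (sym (+-identityʳ (D Fin.zero))) (sd Fin.zero)
sdiam-prodG (suc k) ns G simple ≥3 D sd =
  Two.simple ,
  *-mono-≤ (≥3 Fin.zero) (≤-trans (s≤s z≤n) rest-≥3) ,
  Two.sdiam-□ (≥3 Fin.zero) rest-≥3 (sd Fin.zero) rest-sd
  where
  Rest : Graph (prodN (suc k) (ns ∘ Fin.suc))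
  Rest = prodG (suc k) (ns ∘ Fin.suc) (G ∘ Fin.suc)
  rest : IsSimple Rest × 3 ≤ prodN (suc k) (ns ∘ Fin.suc) × IsSDiam3 Rest (sumF (suc k) (D ∘ Fin.suc))
  rest = sdiam-prodG k (ns ∘ Fin.suc) (G ∘ Fin.suc) (simple ∘ Fin.suc) (≥3 ∘ Fin.suc)
                     (D ∘ Fin.suc) (sd ∘ Fin.suc)
  rest-≥3 : 3 ≤ prodN (suc k) (ns ∘ Fin.suc)
  rest-≥3 = proj₁ (proj₂ rest)
  rest-sd : IsSDiam3 Rest (sumF (suc k) (D ∘ Fin.suc))
  rest-sd = proj₂ (proj₂ rest)
  module Two = Product (G Fin.zero) Rest (simple Fin.zero) (proj₁ rest)

-- The theorem is the case of at least two factors.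
lemma4 : (k : ℕ) → 2 ≤ k → (ns : Fin k → ℕ) → (G : (i : Fin k) → Graph (ns i))
         → (∀ i → IsSimple (G i)) → (∀ i → Connected (G i)) → (∀ i → 3 ≤ ns i)
         → (D : Fin k → ℕ) → (∀ i → IsSDiam3 (G i) (D i))
         → IsSDiam3 (prodG k ns G) (sumF k D)
lemma4 zero          ()
lemma4 (suc zero)    (s≤s ())
lemma4 (suc (suc k)) _ ns G simple _ ≥3 D sd = proj₂ (proj₂ (sdiam-prodG (suc k) ns G simple ≥3 D sd))
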